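{- Let $V_1\subset\mathbb{A}^3$ be the surface with coordinates $(b,x,y)$ defined by $x^2+y^2-(x+by)=0$. Let $P=(b_0,x_0,y_0)$ be any point of $V_1$ not lying on the lines $\{(t,0,0)\}$ and $\{(t,1,0)\}$. Then there exist exactly two lines of $\mathbb{A}^3$ contained in $V_1$ and passing through $P$, namely the lines with parametric equations $$b(t)=b_0+t((x_0-1)^2+y_0^2),\quad x(t)=x_0+t(x_0-1)y_0,\quad y(t)=y_0+ty_0^2,$$ and $$b(t)=b_0+t(x_0^2+y_0^2),\quad x(t)=x_0+tx_0y_0,\quad y(t)=y_0+ty_0^2.$$ The first of these is the same line as $\{(b_0+(b_0^2+1)t,\ x_0+(x_0b_0-y_0)t,\ y_0+(x_0+b_0y_0)t)\}$. If $P$ has integer coordinates, let $d=\gcd(b_0^2+1,x_0+b_0y_0)$ and $D=(b_0^2+1)/d$; then in reduced integer form the first line has $b(t)=b_0+Dt$ and the second line has $b(t)=b_0+dt$.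
   Context: For a line through an integer point $P$ with rational direction, its reduced integer form is the parametrization $t\mapsto P+tw$ where $w$ is the integer direction vector of the line whose entries have greatest common divisor $1$ and whose $b$-coordinate is positive. -}

module Defs where

open import Data.Nat as ℕ using (ℕ)
open import Data.Nat.GCD using (gcd; gcd[m,n]∣m)
open import Data.Nat.Divisibility using (quotient)
open import Data.Integer as ℤ using (ℤ; +_; ∣_∣)
open import Data.Rational using (ℚ; _+_; _*_; _-_; _/_; 0ℚ; 1ℚ)
open import Data.Product using (_×_; _,_; ∃)
open import Relation.Binary.PropositionalEquality using (_≡_; _≢_)

Point : Set
Point = ℚ × ℚ × ℚ

0v : Point
0v = 0ℚ , 0ℚ , 0ℚ

_+ᵥ_ : Point → Point → Point
(a , b , c) +ᵥ (a' , b' , c') = (a + a') , (b + b') , (c + c')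

_·ᵥ_ : ℚ → Point → Point
t ·ᵥ (a , b , c) = (t * a) , (t * b) , (t * c)

OnV1 : Point → Set
OnV1 (b , x , y) = (x * x + y * y) - (x + b * y) ≡ 0ℚ

LineInV1 : Point → Point → Set
LineInV1 P w = ∀ (t : ℚ) → OnV1 (P +ᵥ (t ·ᵥ w))

Parallel : Point → Point → Set
Parallel w w' = ∃ λ (c : ℚ) → (c ≢ 0ℚ) × (w' ≡ c ·ᵥ w)

ZPoint : Set
ZPoint = ℤ × ℤ × ℤ

ℤtoℚ : ℤ → ℚ
ℤtoℚ n = n / 1

toℚ³ : ZPoint → Point
toℚ³ (a , b , c) = ℤtoℚ a , ℤtoℚ b , ℤtoℚ c

ReducedDirection : ZPoint → Set
ReducedDirection (a , b , c) = (gcd (gcd ∣ a ∣ ∣ b ∣) ∣ c ∣ ≡ 1) × (ℤ.+0 ℤ.< a)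

dOf : ℤ → ℤ → ℤ → ℕ
dOf b0 x0 y0 = gcd ∣ b0 ℤ.* b0 ℤ.+ + 1 ∣ ∣ x0 ℤ.+ b0 ℤ.* y0 ∣

DOf : ℤ → ℤ → ℤ → ℕ
DOf b0 x0 y0 = quotient (gcd[m,n]∣m ∣ b0 ℤ.* b0 ℤ.+ + 1 ∣ ∣ x0 ℤ.+ b0 ℤ.* y0 ∣)

-- Along P + t w the equation of V₁ is quadratic in t, so the line lies in V₁
-- iff P ∈ V₁, w is tangent to V₁ at P and w is asymptotic (u² + v² = a v).
-- Off the two excluded lines y₀ ≠ 0. An asymptotic direction then has v ≠ 0
-- and is a multiple of (s² + y₀², s y₀, y₀²), and tangency becomes
-- (s - x₀)(s - x₀ + 1) = 0: exactly two lines, of slopes s = x₀ - 1 and s = x₀.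
--
-- At an integral point let N = b₀² + 1, P = x₀ + b₀ y₀ and Q = 1 - x₀ + b₀ y₀.
-- The two directions are proportional to (N, x₀ b₀ - y₀, P) and
-- (N, x₀ b₀ - b₀ + y₀, Q), and the equation of V₁ gives P Q = y₀² N and puts N in
-- the ideal generated by P N, N Q and P Q. Hence gcd(N, P) gcd(N, Q) = N, and
-- dividing the two vectors by d = gcd(N, P) and by gcd(N, Q) = N / d yields
-- reduced forms with b-coordinates D = N / d and d.

{-# OPTIONS --safe #-}
module Submission where

open import Algebra.Bundles using (Semiring; CommutativeRing)
open import Data.Integer as ℤ using (ℤ; +_; -[1+_]; ∣_∣)
import Data.Integer.Properties as ℤ
import Data.Integer.Divisibility.Signed as ℤ∣
import Data.Integer.Tactic.RingSolver as ℤ-Solver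
open import Data.Nat as ℕ using (ℕ)
import Data.Nat.Properties as ℕ
open import Data.Nat.Divisibility as ℕ∣ using (quotient)
open import Data.Nat.GCD
  using (gcd; gcd[m,n]∣m; gcd[m,n]∣n; gcd-greatest; gcd[m,n]≡0⇒m≡0; c*gcd[m,n]≡gcd[cm,cn])
import Data.Nat.Coprimality as Coprimality
open import Data.Product using (_×_; _,_; ∃; proj₁; proj₂)
open import Data.Rational
  using ( ℚ; mkℚ; ↥_; _/_; _+_; _*_; _-_; -_; 1/_; 0ℚ; 1ℚ
        ; ≢-nonZero; NonZero; NonNegative; Positive; nonNegative; nonPositive)
import Data.Rational.Properties as ℚ
open import Data.Sum as Sum using (_⊎_; inj₁; inj₂; [_,_])
open import Level using (0ℓ)
open import Relation.Nullary using (¬_; yes; no)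
open import Relation.Nullary.Decidable.Core using (dec⇒maybe)
open import Relation.Binary.PropositionalEquality
  using (_≡_; _≢_; refl; sym; trans; cong; cong₂; subst; module ≡-Reasoning)
open import Tactic.RingSolver using (solve-∀)
open import Tactic.RingSolver.Core.AlmostCommutativeRing using (AlmostCommutativeRing; fromCommutativeRing)

open import Defs

ℚ-ring : AlmostCommutativeRing 0ℓ 0ℓ
ℚ-ring = fromCommutativeRing ℚ.+-*-commutativeRing (λ q → dec⇒maybe (0ℚ ℚ.≟ q))

module _ {c ℓ} (R : Semiring c ℓ) where
  private module R = Semiring R
  open import Relation.Binary.Reasoning.Setoid R.setoid

  drop-null-term : ∀ {x y k e} → x R.≈ y R.+ k R.* e → e R.≈ R.0# → x R.≈ y
  drop-null-term {x} {y} {k} {e} x≈y+ke e≈0 = begin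
    x               ≈⟨ x≈y+ke ⟩
    y R.+ k R.* e   ≈⟨ R.+-congˡ (R.*-congˡ e≈0) ⟩
    y R.+ k R.* R.0# ≈⟨ R.+-congˡ (R.zeroʳ k) ⟩
    y R.+ R.0#      ≈⟨ R.+-identityʳ y ⟩
    y               ∎

-- For discharging the hypotheses eᵢ ≡ 0 in a ring identity x = y + Σ kᵢ eᵢ.
-- The coefficients kᵢ are explicit: unification cannot see through ℚ's _+_ and _*_.
drop-null : ∀ {x y e : ℚ} k → x ≡ y + k * e → e ≡ 0ℚ → x ≡ y
drop-null k = drop-null-term (CommutativeRing.semiring ℚ.+-*-commutativeRing) {k = k}

drop-nulls₂ : ∀ {x y e₁ e₂ : ℚ} k₁ k₂ → x ≡ y + k₁ * e₁ + k₂ * e₂ → e₁ ≡ 0ℚ → e₂ ≡ 0ℚ → x ≡ y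
drop-nulls₂ k₁ k₂ eq e₁≡0 e₂≡0 = drop-null k₁ (drop-null k₂ eq e₂≡0) e₁≡0

drop-nulls₃ : ∀ {x y e₁ e₂ e₃ : ℚ} k₁ k₂ k₃ → x ≡ y + k₁ * e₁ + k₂ * e₂ + k₃ * e₃
  → e₁ ≡ 0ℚ → e₂ ≡ 0ℚ → e₃ ≡ 0ℚ → x ≡ y
drop-nulls₃ k₁ k₂ k₃ eq e₁≡0 e₂≡0 e₃≡0 = drop-nulls₂ k₁ k₂ (drop-null k₃ eq e₃≡0) e₁≡0 e₂≡0

1/p*[p*q]≡q : ∀ p q .{{_ : NonZero p}} → 1/ p * (p * q) ≡ q
1/p*[p*q]≡q p q = begin
  1/ p * (p * q)  ≡⟨ ℚ.*-assoc (1/ p) p q ⟨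
  1/ p * p * q    ≡⟨ cong (_* q) (ℚ.*-inverseˡ p) ⟩
  1ℚ * q          ≡⟨ ℚ.*-identityˡ q ⟩
  q               ∎
  where open ≡-Reasoning

*-cancelˡ : ∀ {p q r} → p ≢ 0ℚ → p * q ≡ p * r → q ≡ r
*-cancelˡ {p} {q} {r} p≢0 pq≡pr = begin
  q               ≡⟨ 1/p*[p*q]≡q p q ⟨
  1/ p * (p * q)  ≡⟨ cong (1/ p *_) pq≡pr ⟩
  1/ p * (p * r)  ≡⟨ 1/p*[p*q]≡q p r ⟩
  r               ∎
  where
  open ≡-Reasoning
  instance _ = ≢-nonZero p≢0

p≢0⇒p*q≡0⇒q≡0 : ∀ {p q} → p ≢ 0ℚ → p * q ≡ 0ℚ → q ≡ 0ℚ
p≢0⇒p*q≡0⇒q≡0 {p} p≢0 pq≡0 = *-cancelˡ p≢0 (trans pq≡0 (sym (ℚ.*-zeroʳ p)))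

p*q≡0⇒p≡0⊎q≡0 : ∀ p q → p * q ≡ 0ℚ → p ≡ 0ℚ ⊎ q ≡ 0ℚ
p*q≡0⇒p≡0⊎q≡0 p q pq≡0 with p ℚ.≟ 0ℚ
... | yes p≡0 = inj₁ p≡0
... | no  p≢0 = inj₂ (p≢0⇒p*q≡0⇒q≡0 p≢0 pq≡0)

p*q≢0 : ∀ {p q} → p ≢ 0ℚ → q ≢ 0ℚ → p * q ≢ 0ℚ
p*q≢0 {p} {q} p≢0 q≢0 pq≡0 = [ p≢0 , q≢0 ] (p*q≡0⇒p≡0⊎q≡0 p q pq≡0)

p*p≢0 : ∀ {p} → p ≢ 0ℚ → p * p ≢ 0ℚ
p*p≢0 p≢0 = p*q≢0 p≢0 p≢0

p*p+q*q≢0 : ∀ p {q} → q ≢ 0ℚ → p * p + q * q ≢ 0ℚ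
p*p+q*q≢0 p {q} q≢0 sum≡0 = positive≢0 (subst Positive sum≡0 (ℚ.nonNeg+pos⇒pos (p * p) (q * q)))
  where
  square-nonNegative : ∀ r → NonNegative (r * r)
  square-nonNegative r with ℚ.≤-total 0ℚ r
  ... | inj₁ 0≤r = ℚ.nonNeg*nonNeg⇒nonNeg r r where instance _ = nonNegative 0≤r
  ... | inj₂ r≤0 = ℚ.nonPos*nonPos⇒nonPos r r where instance _ = nonPositive r≤0
  positive≢0 : ¬ Positive 0ℚ
  positive≢0 ()
  instance
    _ = square-nonNegative p
    _ = ℚ.nonNeg∧nonZero⇒pos (q * q) {{square-nonNegative q}} {{≢-nonZero (p*p≢0 q≢0)}}

p-q≡0⇒p≡q : ∀ {p q} → p - q ≡ 0ℚ → p ≡ q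
p-q≡0⇒p≡q {p} {q} p-q≡0 = begin
  p             ≡⟨ identity p q ⟩
  p - q + q     ≡⟨ cong (_+ q) p-q≡0 ⟩
  0ℚ + q        ≡⟨ ℚ.+-identityˡ q ⟩
  q             ∎
  where
  open ≡-Reasoning
  identity : ∀ p q → p ≡ p - q + q
  identity = solve-∀ ℚ-ring

p≡q⇒p-q≡0 : ∀ {p q} → p ≡ q → p - q ≡ 0ℚ
p≡q⇒p-q≡0 {p} refl = ℚ.+-inverseʳ p

quadratic-coefficients≡0 : ∀ e l q → (∀ t → e + t * l + t * t * q ≡ 0ℚ)
  → e ≡ 0ℚ × l ≡ 0ℚ × q ≡ 0ℚ
quadratic-coefficients≡0 e l q f≡0 = e≡0 , l≡0 , q≡0
  where
  two≢0 : 1ℚ + 1ℚ ≢ 0ℚ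
  two≢0 ()
  at-0 : ∀ e l q → e ≡ e + 0ℚ * l + 0ℚ * 0ℚ * q
  at-0 = solve-∀ ℚ-ring
  at±1-difference : ∀ e l q →
    (1ℚ + 1ℚ) * l ≡ (e + 1ℚ * l + 1ℚ * 1ℚ * q) - (e + (- 1ℚ) * l + (- 1ℚ) * (- 1ℚ) * q)
  at±1-difference = solve-∀ ℚ-ring
  at±1-sum : ∀ e l q →
    (1ℚ + 1ℚ) * q ≡ (e + 1ℚ * l + 1ℚ * 1ℚ * q) + (e + (- 1ℚ) * l + (- 1ℚ) * (- 1ℚ) * q) - (1ℚ + 1ℚ) * e
  at±1-sum = solve-∀ ℚ-ring
  e≡0 : e ≡ 0ℚ
  e≡0 = trans (at-0 e l q) (f≡0 0ℚ)
  l≡0 : l ≡ 0ℚ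
  l≡0 = p≢0⇒p*q≡0⇒q≡0 two≢0 (trans (at±1-difference e l q) (cong₂ _-_ (f≡0 1ℚ) (f≡0 (- 1ℚ))))
  q≡0 : q ≡ 0ℚ
  q≡0 = p≢0⇒p*q≡0⇒q≡0 two≢0 (begin
    (1ℚ + 1ℚ) * q
      ≡⟨ at±1-sum e l q ⟩
    (e + 1ℚ * l + 1ℚ * 1ℚ * q) + (e + (- 1ℚ) * l + (- 1ℚ) * (- 1ℚ) * q) - (1ℚ + 1ℚ) * e
      ≡⟨ cong₂ _-_ (cong₂ _+_ (f≡0 1ℚ) (f≡0 (- 1ℚ))) (cong ((1ℚ + 1ℚ) *_) e≡0) ⟩
    0ℚ ∎)
    where open ≡-Reasoning

parallel-sym : ∀ {w w′} → Parallel w w′ → Parallel w′ w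
parallel-sym {a , u , v} (c , c≢0 , refl) =
  1/ c , 1/c≢0 , cong₂ _,_ (back a) (cong₂ _,_ (back u) (back v))
  where
  instance _ = ≢-nonZero c≢0
  back : ∀ p → p ≡ 1/ c * (c * p)
  back p = sym (1/p*[p*q]≡q c p)
  1/c≢0 : 1/ c ≢ 0ℚ
  1/c≢0 1/c≡0 = ℚ.1≢0 (trans (sym (ℚ.*-inverseˡ c)) (trans (cong (_* c) 1/c≡0) (ℚ.*-zeroˡ c)))

parallel-trans : ∀ {w w′ w″} → Parallel w w′ → Parallel w′ w″ → Parallel w w″
parallel-trans {a , u , v} (c , c≢0 , refl) (c′ , c′≢0 , refl) =
  c′ * c , p*q≢0 c′≢0 c≢0 , cong₂ _,_ (assoc a) (cong₂ _,_ (assoc u) (assoc v))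
  where
  assoc : ∀ p → c′ * (c * p) ≡ c′ * c * p
  assoc p = sym (ℚ.*-assoc c′ c p)

parallel-of-minors : ∀ {a u v a′ u′ v′} → v ≢ 0ℚ → v′ ≢ 0ℚ
  → v * a′ ≡ v′ * a → v * u′ ≡ v′ * u → Parallel (a , u , v) (a′ , u′ , v′)
parallel-of-minors {a} {u} {v} {a′} {u′} {v′} v≢0 v′≢0 minor-a minor-u =
  c , c≢0 , cong₂ _,_ (scaled minor-a) (cong₂ _,_ (scaled minor-u) v′≡c*v)
  where
  instance _ = ≢-nonZero v≢0
  c : ℚ
  c = v′ * 1/ v
  identity : ∀ v v′ p w → v * (v′ * w * p) ≡ v′ * p * (v * w)
  identity = solve-∀ ℚ-ring
  scaled : ∀ {p p′} → v * p′ ≡ v′ * p → p′ ≡ c * p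
  scaled {p} {p′} minor = *-cancelˡ v≢0 (begin
    v * p′                ≡⟨ minor ⟩
    v′ * p                ≡⟨ ℚ.*-identityʳ (v′ * p) ⟨
    v′ * p * 1ℚ           ≡⟨ cong (v′ * p *_) (ℚ.*-inverseʳ v) ⟨
    v′ * p * (v * 1/ v)   ≡⟨ identity v v′ p (1/ v) ⟨
    v * (c * p)           ∎)
    where open ≡-Reasoning
  v′≡c*v : v′ ≡ c * v
  v′≡c*v = scaled (ℚ.*-comm v v′)
  c≢0 : c ≢ 0ℚ
  c≢0 c≡0 = v′≢0 (trans v′≡c*v (trans (cong (_* v) c≡0) (ℚ.*-zeroˡ v)))

third≢0⇒≢0v : ∀ {a u v} → v ≢ 0ℚ → (a , u , v) ≢ 0v
third≢0⇒≢0v v≢0 refl = v≢0 refl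

TangentToV1 : Point → Point → Set
TangentToV1 (b , x , y) (a , u , v) = ((x * u + x * u) + (y * v + y * v)) - (u + b * v + a * y) ≡ 0ℚ

AsymptoticToV1 : Point → Set
AsymptoticToV1 (a , u , v) = (u * u + v * v) - a * v ≡ 0ℚ

line-in-V₁⇒tangent-asymptotic : ∀ P w → LineInV1 P w → OnV1 P × TangentToV1 P w × AsymptoticToV1 w
line-in-V₁⇒tangent-asymptotic (b , x , y) (a , u , v) line =
  quadratic-coefficients≡0 _ _ _ (λ t → trans (sym (expansion b x y a u v t)) (line t))
  where
  expansion : ∀ b x y a u v t →
    ((x + t * u) * (x + t * u) + (y + t * v) * (y + t * v)) - ((x + t * u) + (b + t * a) * (y + t * v))
    ≡ (x * x + y * y) - (x + b * y)
      + t * (((x * u + x * u) + (y * v + y * v)) - (u + b * v + a * y))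
      + t * t * ((u * u + v * v) - a * v)
  expansion = solve-∀ ℚ-ring

off-lines⇒y≢0 : ∀ b x y → OnV1 (b , x , y)
  → ¬ (x ≡ 0ℚ × y ≡ 0ℚ) → ¬ (x ≡ 1ℚ × y ≡ 0ℚ) → y ≢ 0ℚ
off-lines⇒y≢0 b x _ P∈V₁ off₀ off₁ refl =
  [ (λ x≡0 → off₀ (x≡0 , refl)) , (λ x-1≡0 → off₁ (p-q≡0⇒p≡q x-1≡0 , refl)) ]
    (p*q≡0⇒p≡0⊎q≡0 x (x - 1ℚ) (trans (identity b x) P∈V₁))
  where
  identity : ∀ b x → x * (x - 1ℚ) ≡ (x * x + 0ℚ * 0ℚ) - (x + b * 0ℚ)
  identity = solve-∀ ℚ-ring

-- cone s y = y² (σ² + 1, σ, 1) with σ = s / y: the asymptotic direction of slope u / v = σ.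
cone : ℚ → ℚ → Point
cone s y = (s * s + y * y) , s * y , y * y

cone≢0v : ∀ s {y} → y ≢ 0ℚ → cone s y ≢ 0v
cone≢0v s y≢0 = third≢0⇒≢0v (p*p≢0 y≢0)

cone-line-in-V₁ : ∀ b x y s → OnV1 (b , x , y) → (s - x) * (s - (x - 1ℚ)) ≡ 0ℚ
  → LineInV1 (b , x , y) (cone s y)
cone-line-in-V₁ b x y s P∈V₁ s-is-root t =
  drop-nulls₂ (1ℚ + t * y) (- (t * y)) (identity b x y s t) P∈V₁ s-is-root
  where
  identity : ∀ b x y s t →
    ((x + t * (s * y)) * (x + t * (s * y)) + (y + t * (y * y)) * (y + t * (y * y)))
      - ((x + t * (s * y)) + (b + t * (s * s + y * y)) * (y + t * (y * y)))
    ≡ 0ℚ + (1ℚ + t * y) * ((x * x + y * y) - (x + b * y)) + (- (t * y)) * ((s - x) * (s - (x - 1ℚ)))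
  identity = solve-∀ ℚ-ring

x-1-is-root : ∀ x → (x - 1ℚ - x) * (x - 1ℚ - (x - 1ℚ)) ≡ 0ℚ
x-1-is-root x = trans (cong ((x - 1ℚ - x) *_) (ℚ.+-inverseʳ (x - 1ℚ))) (ℚ.*-zeroʳ (x - 1ℚ - x))

x-is-root : ∀ x → (x - x) * (x - (x - 1ℚ)) ≡ 0ℚ
x-is-root x = trans (cong (_* (x - (x - 1ℚ))) (ℚ.+-inverseʳ x)) (ℚ.*-zeroˡ (x - (x - 1ℚ)))

on-cone⇒parallel : ∀ {s y a u v} → y ≢ 0ℚ → v ≢ 0ℚ → AsymptoticToV1 (a , u , v) → u * y - v * s ≡ 0ℚ
  → Parallel (cone s y) (a , u , v)
on-cone⇒parallel {s} {y} {a} {u} {v} y≢0 v≢0 on-cone same-slope =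
  parallel-of-minors (p*p≢0 y≢0) v≢0 minor-a minor-u
  where
  identity-a : ∀ s y a u v → v * (y * y * a)
    ≡ v * (v * (s * s + y * y)) + (- (y * y)) * ((u * u + v * v) - a * v) + (u * y + v * s) * (u * y - v * s)
  identity-a = solve-∀ ℚ-ring
  identity-u : ∀ s y u v → y * y * u ≡ v * (s * y) + y * (u * y - v * s)
  identity-u = solve-∀ ℚ-ring
  minor-a : y * y * a ≡ v * (s * s + y * y)
  minor-a = *-cancelˡ v≢0 (drop-nulls₂ (- (y * y)) (u * y + v * s) (identity-a s y a u v) on-cone same-slope)
  minor-u : y * y * u ≡ v * (s * y)
  minor-u = drop-null y (identity-u s y u v) same-slope

direction-in-V₁⇒third≢0 : ∀ {b x y a u v} → y ≢ 0ℚ → (a , u , v) ≢ 0v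
  → TangentToV1 (b , x , y) (a , u , v) → AsymptoticToV1 (a , u , v) → v ≢ 0ℚ
direction-in-V₁⇒third≢0 {b} {x} {y} {a} {u} {v} y≢0 w≢0 tangent on-cone v≡0 =
  w≢0 (cong₂ _,_ a≡0 (cong₂ _,_ u≡0 v≡0))
  where
  identity-u : ∀ a u v → u * u ≡ 0ℚ + 1ℚ * ((u * u + v * v) - a * v) + (a - v) * v
  identity-u = solve-∀ ℚ-ring
  identity-a : ∀ b x y a u v → y * a
    ≡ 0ℚ + (x + x - 1ℚ) * u + (y + y - b) * v + (- 1ℚ) * (((x * u + x * u) + (y * v + y * v)) - (u + b * v + a * y))
  identity-a = solve-∀ ℚ-ring
  u≡0 : u ≡ 0ℚ
  u≡0 = Sum.reduce (p*q≡0⇒p≡0⊎q≡0 u u (drop-nulls₂ 1ℚ (a - v) (identity-u a u v) on-cone v≡0))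
  a≡0 : a ≡ 0ℚ
  a≡0 = p≢0⇒p*q≡0⇒q≡0 y≢0 (drop-nulls₃ (x + x - 1ℚ) (y + y - b) (- 1ℚ) (identity-a b x y a u v) u≡0 v≡0 tangent)

line-in-V₁⇒parallel : ∀ b x y w → y ≢ 0ℚ → w ≢ 0v → LineInV1 (b , x , y) w
  → Parallel (cone (x - 1ℚ) y) w ⊎ Parallel (cone x y) w
line-in-V₁⇒parallel b x y (a , u , v) y≢0 w≢0 line =
  Sum.map (on-cone⇒parallel y≢0 v≢0 on-cone) (on-cone⇒parallel y≢0 v≢0 on-cone)
    (p*q≡0⇒p≡0⊎q≡0 _ _ slopes)
  where
  coefficients : OnV1 (b , x , y) × TangentToV1 (b , x , y) (a , u , v) × AsymptoticToV1 (a , u , v)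
  coefficients = line-in-V₁⇒tangent-asymptotic (b , x , y) (a , u , v) line
  P∈V₁ : OnV1 (b , x , y)
  P∈V₁ = proj₁ coefficients
  tangent : TangentToV1 (b , x , y) (a , u , v)
  tangent = proj₁ (proj₂ coefficients)
  on-cone : AsymptoticToV1 (a , u , v)
  on-cone = proj₂ (proj₂ coefficients)
  v≢0 : v ≢ 0ℚ
  v≢0 = direction-in-V₁⇒third≢0 {b} {x} y≢0 w≢0 tangent on-cone
  identity : ∀ b x y a u v → (u * y - v * (x - 1ℚ)) * (u * y - v * x)
    ≡ 0ℚ + y * y * ((u * u + v * v) - a * v)
         + (- (v * y)) * (((x * u + x * u) + (y * v + y * v)) - (u + b * v + a * y))
         + v * v * ((x * x + y * y) - (x + b * y))
  identity = solve-∀ ℚ-ring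
  slopes : (u * y - v * (x - 1ℚ)) * (u * y - v * x) ≡ 0ℚ
  slopes = drop-nulls₃ (y * y) (- (v * y)) (v * v) (identity b x y a u v) on-cone tangent P∈V₁

cone-parallel⇒same-slope : ∀ {s s′ y} → y ≢ 0ℚ → Parallel (cone s y) (cone s′ y) → s′ ≡ s
cone-parallel⇒same-slope {s} {s′} {y} y≢0 (c , _ , eq) =
  p-q≡0⇒p≡q (p≢0⇒p*q≡0⇒q≡0 y≢0 (p≢0⇒p*q≡0⇒q≡0 (p*p≢0 y≢0)
    (drop-nulls₂ (y * y) (- (s * y)) (identity s s′ y c) (p≡q⇒p-q≡0 second) (p≡q⇒p-q≡0 third))))
  where
  second : s′ * y ≡ c * (s * y)
  second = cong (λ w → proj₁ (proj₂ w)) eq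
  third : y * y ≡ c * (y * y)
  third = cong (λ w → proj₂ (proj₂ w)) eq
  identity : ∀ s s′ y c → y * y * (y * (s′ - s))
    ≡ 0ℚ + y * y * (s′ * y - c * (s * y)) + (- (s * y)) * (y * y - c * (y * y))
  identity = solve-∀ ℚ-ring

cones-not-parallel : ∀ x {y} → y ≢ 0ℚ → ¬ Parallel (cone (x - 1ℚ) y) (cone x y)
cones-not-parallel x y≢0 parallel = ℚ.1≢0 (begin
  1ℚ             ≡⟨ identity x ⟩
  x - (x - 1ℚ)   ≡⟨ cong (λ s → x - s) (cone-parallel⇒same-slope y≢0 parallel) ⟨
  x - x          ≡⟨ ℚ.+-inverseʳ x ⟩
  0ℚ             ∎)
  where
  open ≡-Reasoning
  identity : ∀ x → 1ℚ ≡ x - (x - 1ℚ)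
  identity = solve-∀ ℚ-ring

w₁′ w₂′ : Point → Point
w₁′ (b , x , y) = (b * b + 1ℚ) , (x * b - y) , (x + b * y)
w₂′ (b , x , y) = (b * b + 1ℚ) , (x * b - b + y) , (1ℚ - x + b * y)

cone∥w₁′ : ∀ b x y → OnV1 (b , x , y) → y ≢ 0ℚ → Parallel (cone (x - 1ℚ) y) (w₁′ (b , x , y))
cone∥w₁′ b x y P∈V₁ y≢0 = parallel-of-minors (p*p≢0 y≢0) third≢0
  (drop-null (1ℚ - x - b * y) (minor-a b x y) P∈V₁) (drop-null (- y) (minor-u b x y) P∈V₁)
  where
  third : ∀ b x y → x + b * y ≡ x * x + y * y + (- 1ℚ) * ((x * x + y * y) - (x + b * y))
  third = solve-∀ ℚ-ring
  third≢0 : x + b * y ≢ 0ℚ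
  third≢0 = subst (_≢ 0ℚ) (sym (drop-null (- 1ℚ) (third b x y) P∈V₁)) (p*p+q*q≢0 x y≢0)
  minor-a : ∀ b x y → y * y * (b * b + 1ℚ)
    ≡ (x + b * y) * ((x - 1ℚ) * (x - 1ℚ) + y * y) + (1ℚ - x - b * y) * ((x * x + y * y) - (x + b * y))
  minor-a = solve-∀ ℚ-ring
  minor-u : ∀ b x y → y * y * (x * b - y)
    ≡ (x + b * y) * ((x - 1ℚ) * y) + (- y) * ((x * x + y * y) - (x + b * y))
  minor-u = solve-∀ ℚ-ring

cone∥w₂′ : ∀ b x y → OnV1 (b , x , y) → y ≢ 0ℚ → Parallel (cone x y) (w₂′ (b , x , y))
cone∥w₂′ b x y P∈V₁ y≢0 = parallel-of-minors (p*p≢0 y≢0) third≢0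
  (drop-null (x - b * y) (minor-a b x y) P∈V₁) (drop-null y (minor-u b x y) P∈V₁)
  where
  third : ∀ b x y → 1ℚ - x + b * y ≡ (x - 1ℚ) * (x - 1ℚ) + y * y + (- 1ℚ) * ((x * x + y * y) - (x + b * y))
  third = solve-∀ ℚ-ring
  third≢0 : 1ℚ - x + b * y ≢ 0ℚ
  third≢0 = subst (_≢ 0ℚ) (sym (drop-null (- 1ℚ) (third b x y) P∈V₁)) (p*p+q*q≢0 (x - 1ℚ) y≢0)
  minor-a : ∀ b x y → y * y * (b * b + 1ℚ)
    ≡ (1ℚ - x + b * y) * (x * x + y * y) + (x - b * y) * ((x * x + y * y) - (x + b * y))
  minor-a = solve-∀ ℚ-ring
  minor-u : ∀ b x y → y * y * (x * b - b + y)
    ≡ (1ℚ - x + b * y) * (x * y) + y * ((x * x + y * y) - (x + b * y))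
  minor-u = solve-∀ ℚ-ring

ℤtoℚ≡mkℚ : ∀ i → ℤtoℚ i ≡ mkℚ i 0 (Coprimality.sym (Coprimality.1-coprimeTo ∣ i ∣))
ℤtoℚ≡mkℚ (+ n)    = ℚ.normalize-coprime (Coprimality.sym (Coprimality.1-coprimeTo n))
ℤtoℚ≡mkℚ -[1+ n ] = cong -_ (ℚ.normalize-coprime (Coprimality.sym (Coprimality.1-coprimeTo (ℕ.suc n))))

ℤtoℚ-injective : ∀ {i j} → ℤtoℚ i ≡ ℤtoℚ j → i ≡ j
ℤtoℚ-injective {i} {j} eq = cong ↥_ (trans (sym (ℤtoℚ≡mkℚ i)) (trans eq (ℤtoℚ≡mkℚ j)))

ℤtoℚ-* : ∀ i j → ℤtoℚ (i ℤ.* j) ≡ ℤtoℚ i * ℤtoℚ j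
ℤtoℚ-* i j = sym (cong₂ _*_ (ℤtoℚ≡mkℚ i) (ℤtoℚ≡mkℚ j))

ℤtoℚ-+ : ∀ i j → ℤtoℚ (i ℤ.+ j) ≡ ℤtoℚ i + ℤtoℚ j
ℤtoℚ-+ i j = trans (cong (λ k → k / 1) (sym (cong₂ ℤ._+_ (ℤ.*-identityʳ i) (ℤ.*-identityʳ j))))
                   (sym (cong₂ _+_ (ℤtoℚ≡mkℚ i) (ℤtoℚ≡mkℚ j)))

ℤtoℚ-neg : ∀ i → ℤtoℚ (ℤ.- i) ≡ - ℤtoℚ i
ℤtoℚ-neg (+ 0)      = refl
ℤtoℚ-neg (+ ℕ.suc n) = refl
ℤtoℚ-neg -[1+ n ]   = trans (ℤtoℚ≡mkℚ (+ ℕ.suc n)) (cong (λ q → - (- q)) (sym (ℤtoℚ≡mkℚ (+ ℕ.suc n))))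

ℤtoℚ-- : ∀ i j → ℤtoℚ (i ℤ.- j) ≡ ℤtoℚ i - ℤtoℚ j
ℤtoℚ-- i j = trans (ℤtoℚ-+ i (ℤ.- j)) (cong (λ q → ℤtoℚ i + q) (ℤtoℚ-neg j))

ℤtoℚ-scaled : ∀ {i} j k → i ≡ j ℤ.* k → ℤtoℚ i ≡ ℤtoℚ k * ℤtoℚ j
ℤtoℚ-scaled j k refl = trans (ℤtoℚ-* j k) (ℚ.*-comm (ℤtoℚ j) (ℤtoℚ k))

gcd-of-cofactors : ∀ {m n g} a b → g ≢ 0 → m ≡ a ℕ.* g → n ≡ b ℕ.* g → gcd m n ≡ g → gcd a b ≡ 1
gcd-of-cofactors {g = g} a b g≢0 refl refl gcd≡g = ℕ.*-cancelˡ-≡ (gcd a b) 1 g (begin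
  g ℕ.* gcd a b            ≡⟨ c*gcd[m,n]≡gcd[cm,cn] g a b ⟩
  gcd (g ℕ.* a) (g ℕ.* b)  ≡⟨ cong₂ gcd (ℕ.*-comm g a) (ℕ.*-comm g b) ⟩
  gcd (a ℕ.* g) (b ℕ.* g)  ≡⟨ gcd≡g ⟩
  g                        ≡⟨ ℕ.*-identityʳ g ⟨
  g ℕ.* 1                  ∎)
  where
  open ≡-Reasoning
  instance _ = ℕ.≢-nonZero g≢0

coprime⇒reduced : ∀ {a} m {r} → a ≢ 0 → gcd a ∣ r ∣ ≡ 1 → ReducedDirection (+ a , m , r)
coprime⇒reduced {a} m {r} a≢0 gcd≡1 =
  ℕ∣.∣1⇒≡1 (subst (gcd (gcd a ∣ m ∣) ∣ r ∣ ℕ∣.∣_) gcd≡1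
    (gcd-greatest (ℕ∣.∣-trans (gcd[m,n]∣m (gcd a ∣ m ∣) ∣ r ∣) (gcd[m,n]∣m a ∣ m ∣))
                  (gcd[m,n]∣n (gcd a ∣ m ∣) ∣ r ∣)))
  , ℤ.+<+ (ℕ.n≢0⇒n>0 a≢0)

n∣pq⇒n∣gcd[n,p]*gcd[n,q] : ∀ n p q → n ℕ∣.∣ p ℕ.* q → n ℕ∣.∣ gcd n p ℕ.* gcd n q
n∣pq⇒n∣gcd[n,p]*gcd[n,q] n p q n∣pq =
  subst (n ℕ∣.∣_) (sym (c*gcd[m,n]≡gcd[cm,cn] (gcd n p) n q))
    (gcd-greatest (ℕ∣.n∣m*n (gcd n p)) (subst (n ℕ∣.∣_) (sym g*q≡gcd) (gcd-greatest (ℕ∣.n∣m*n q) n∣qp)))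
  where
  g*q≡gcd : gcd n p ℕ.* q ≡ gcd (q ℕ.* n) (q ℕ.* p)
  g*q≡gcd = trans (ℕ.*-comm (gcd n p) q) (c*gcd[m,n]≡gcd[cm,cn] q n p)
  n∣qp : n ℕ∣.∣ q ℕ.* p
  n∣qp = subst (n ℕ∣.∣_) (ℕ.*-comm p q) n∣pq

*-pres-∣ : ∀ {a b c d} → a ℤ∣.∣ b → c ℤ∣.∣ d → a ℤ.* c ℤ∣.∣ b ℤ.* d
*-pres-∣ {b = b} {c} a∣b c∣d = ℤ∣.∣-trans (ℤ∣.*-monoˡ-∣ c a∣b) (ℤ∣.*-monoʳ-∣ b c∣d)

*-∣-of-combination : ∀ {d h N P Q} K₁ K₂ K₃ → d ℤ∣.∣ N → d ℤ∣.∣ P → h ℤ∣.∣ N → h ℤ∣.∣ Q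
  → N ≡ K₁ ℤ.* (P ℤ.* N) ℤ.+ K₂ ℤ.* (N ℤ.* Q) ℤ.+ K₃ ℤ.* (P ℤ.* Q) → d ℤ.* h ℤ∣.∣ N
*-∣-of-combination K₁ K₂ K₃ d∣N d∣P h∣N h∣Q combination =
  subst (_ ℤ∣.∣_) (sym combination)
    (ℤ∣.∣m∣n⇒∣m+n (ℤ∣.∣m∣n⇒∣m+n (ℤ∣.∣n⇒∣m*n K₁ (*-pres-∣ d∣P h∣N)) (ℤ∣.∣n⇒∣m*n K₂ (*-pres-∣ d∣N h∣Q)))
                  (ℤ∣.∣n⇒∣m*n K₃ (*-pres-∣ d∣P h∣Q)))

gcd[N,P]*gcd[N,Q]≡∣N∣ : ∀ N P Q K₁ K₂ K₃ → N ℤ∣.∣ P ℤ.* Q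
  → N ≡ K₁ ℤ.* (P ℤ.* N) ℤ.+ K₂ ℤ.* (N ℤ.* Q) ℤ.+ K₃ ℤ.* (P ℤ.* Q)
  → gcd ∣ N ∣ ∣ P ∣ ℕ.* (gcd ∣ N ∣ ∣ Q ∣) ≡ ∣ N ∣
gcd[N,P]*gcd[N,Q]≡∣N∣ N P Q K₁ K₂ K₃ N∣PQ combination = ℕ∣.∣-antisym dh∣N N∣dh
  where
  n = ∣ N ∣
  dh∣N : gcd n ∣ P ∣ ℕ.* (gcd n ∣ Q ∣) ℕ∣.∣ n
  dh∣N = subst (ℕ∣._∣ n) (ℤ.abs-* (+ gcd n ∣ P ∣) (+ gcd n ∣ Q ∣))
    (ℤ∣.∣⇒∣ᵤ (*-∣-of-combination {+ gcd n ∣ P ∣} {+ gcd n ∣ Q ∣} {N} {P} {Q} K₁ K₂ K₃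
      (ℤ∣.∣ᵤ⇒∣ (gcd[m,n]∣m n ∣ P ∣)) (ℤ∣.∣ᵤ⇒∣ (gcd[m,n]∣n n ∣ P ∣))
      (ℤ∣.∣ᵤ⇒∣ (gcd[m,n]∣m n ∣ Q ∣)) (ℤ∣.∣ᵤ⇒∣ (gcd[m,n]∣n n ∣ Q ∣)) combination))
  N∣dh : n ℕ∣.∣ gcd n ∣ P ∣ ℕ.* (gcd n ∣ Q ∣)
  N∣dh = n∣pq⇒n∣gcd[n,p]*gcd[n,q] n ∣ P ∣ ∣ Q ∣ (subst (n ℕ∣.∣_) (ℤ.abs-* P Q) (ℤ∣.∣⇒∣ᵤ N∣PQ))

-- As gcd(n, R) ∣ M, dividing by gcd(n, R) already gives the reduced form.
reduced-form : ∀ n M R → n ≢ 0 → + gcd n ∣ R ∣ ℤ∣.∣ M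
  → ∃ λ v → ReducedDirection v × Parallel (toℚ³ (+ n , M , R)) (toℚ³ v)
            × proj₁ v ≡ + quotient (gcd[m,n]∣m n ∣ R ∣)
reduced-form n M R n≢0 g∣M =
  (+ D , M′ , R′) , coprime⇒reduced {D} M′ {R′} D≢0 coprime , parallel-sym scaling , refl
  where
  g D : ℕ
  g = gcd n ∣ R ∣
  D = quotient (gcd[m,n]∣m n ∣ R ∣)
  n≡D*g : n ≡ D ℕ.* g
  n≡D*g = ℕ∣.m∣n⇒n≡quotient*m (gcd[m,n]∣m n ∣ R ∣)
  g∣R : + g ℤ∣.∣ R
  g∣R = ℤ∣.∣ᵤ⇒∣ (gcd[m,n]∣n n ∣ R ∣)
  R′ M′ : ℤ
  R′ = ℤ∣.quotient g∣R
  M′ = ℤ∣.quotient g∣M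
  g≢0 : g ≢ 0
  g≢0 g≡0 = n≢0 (gcd[m,n]≡0⇒m≡0 g≡0)
  D≢0 : D ≢ 0
  D≢0 D≡0 = n≢0 (trans n≡D*g (cong (ℕ._* g) D≡0))
  coprime : gcd D ∣ R′ ∣ ≡ 1
  coprime = gcd-of-cofactors D ∣ R′ ∣ g≢0 n≡D*g (trans (cong ∣_∣ (ℤ∣._∣_.equality g∣R)) (ℤ.abs-* R′ (+ g))) refl
  scaling : Parallel (toℚ³ (+ D , M′ , R′)) (toℚ³ (+ n , M , R))
  scaling = ℤtoℚ (+ g) , (λ ĝ≡0 → g≢0 (ℤ.+-injective (ℤtoℚ-injective ĝ≡0))) ,
    cong₂ _,_ (ℤtoℚ-scaled (+ D) (+ g) (trans (cong +_ n≡D*g) (ℤ.pos-* D g)))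
      (cong₂ _,_ (ℤtoℚ-scaled M′ (+ g) (ℤ∣._∣_.equality g∣M)) (ℤtoℚ-scaled R′ (+ g) (ℤ∣._∣_.equality g∣R)))

drop-nullᶻ : ∀ {x y e : ℤ} k → x ≡ y ℤ.+ k ℤ.* e → e ≡ + 0 → x ≡ y
drop-nullᶻ k = drop-null-term ℤ.+-*-semiring {k = k}

module IntegralPoint (B X Y : ℤ) (on-V₁ : X ℤ.* X ℤ.+ Y ℤ.* Y ℤ.- (X ℤ.+ B ℤ.* Y) ≡ + 0) where

  N P Q : ℤ
  N = B ℤ.* B ℤ.+ + 1
  P = X ℤ.+ B ℤ.* Y
  Q = + 1 ℤ.- X ℤ.+ B ℤ.* Y

  n d h : ℕ
  n = ∣ N ∣
  d = gcd n ∣ P ∣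
  h = gcd n ∣ Q ∣

  N≡+[∣B∣²+1] : N ≡ + (∣ B ∣ ℕ.* ∣ B ∣ ℕ.+ 1)
  N≡+[∣B∣²+1] = cong (ℤ._+ + 1) (square B)
    where
    square : ∀ i → i ℤ.* i ≡ + (∣ i ∣ ℕ.* ∣ i ∣)
    square (+ m)    = sym (ℤ.pos-* m m)
    square -[1+ m ] = refl

  +n≡N : + n ≡ N
  +n≡N = trans (cong (λ z → + ∣ z ∣) N≡+[∣B∣²+1]) (sym N≡+[∣B∣²+1])

  n≢0 : n ≢ 0
  n≢0 n≡0 = ℕ.m+1+n≢0 (∣ B ∣ ℕ.* ∣ B ∣) (trans (sym (cong ∣_∣ N≡+[∣B∣²+1])) n≡0)

  P*Q≡Y²N : P ℤ.* Q ≡ Y ℤ.* Y ℤ.* N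
  P*Q≡Y²N = drop-nullᶻ (ℤ.- + 1) (identity B X Y) on-V₁
    where
    identity : ∀ B X Y → (X ℤ.+ B ℤ.* Y) ℤ.* (+ 1 ℤ.- X ℤ.+ B ℤ.* Y)
      ≡ Y ℤ.* Y ℤ.* (B ℤ.* B ℤ.+ + 1) ℤ.+ (ℤ.- + 1) ℤ.* (X ℤ.* X ℤ.+ Y ℤ.* Y ℤ.- (X ℤ.+ B ℤ.* Y))
    identity = ℤ-Solver.solve-∀

  -- N (2P + 2Q - (P - Q)² - 4Y²) = N by the equation of V₁, and 4 Y² N = 4 P Q.
  N≡combination : N ≡ (+ 2 ℤ.- P ℤ.+ + 2 ℤ.* Q) ℤ.* (P ℤ.* N) ℤ.+ (+ 2 ℤ.- Q) ℤ.* (N ℤ.* Q)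
                      ℤ.+ (ℤ.- + 4) ℤ.* (P ℤ.* Q)
  N≡combination = drop-nullᶻ (+ 4 ℤ.* B ℤ.* B) (identity B X Y) on-V₁
    where
    identity : ∀ B X Y → B ℤ.* B ℤ.+ + 1
      ≡ (+ 2 ℤ.- (X ℤ.+ B ℤ.* Y) ℤ.+ + 2 ℤ.* (+ 1 ℤ.- X ℤ.+ B ℤ.* Y))
          ℤ.* ((X ℤ.+ B ℤ.* Y) ℤ.* (B ℤ.* B ℤ.+ + 1))
        ℤ.+ (+ 2 ℤ.- (+ 1 ℤ.- X ℤ.+ B ℤ.* Y)) ℤ.* ((B ℤ.* B ℤ.+ + 1) ℤ.* (+ 1 ℤ.- X ℤ.+ B ℤ.* Y))
        ℤ.+ (ℤ.- + 4) ℤ.* ((X ℤ.+ B ℤ.* Y) ℤ.* (+ 1 ℤ.- X ℤ.+ B ℤ.* Y))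
        ℤ.+ (+ 4 ℤ.* B ℤ.* B) ℤ.* (X ℤ.* X ℤ.+ Y ℤ.* Y ℤ.- (X ℤ.+ B ℤ.* Y))
    identity = ℤ-Solver.solve-∀

  d*h≡n : d ℕ.* h ≡ n
  d*h≡n = gcd[N,P]*gcd[N,Q]≡∣N∣ N P Q (+ 2 ℤ.- P ℤ.+ + 2 ℤ.* Q) (+ 2 ℤ.- Q) (ℤ.- + 4)
    (ℤ∣.divides (Y ℤ.* Y) P*Q≡Y²N) N≡combination

  n/h≡d : quotient (gcd[m,n]∣m n ∣ Q ∣) ≡ d
  n/h≡d = ℕ.*-cancelʳ-≡ _ d h (trans (sym (ℕ∣.m∣n⇒n≡quotient*m (gcd[m,n]∣m n ∣ Q ∣))) (sym d*h≡n))
    where instance _ = ℕ.≢-nonZero (λ h≡0 → n≢0 (gcd[m,n]≡0⇒m≡0 h≡0))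

  d∣XB-Y : + d ℤ∣.∣ X ℤ.* B ℤ.- Y
  d∣XB-Y = subst (+ d ℤ∣.∣_) (sym (identity B X Y))
    (ℤ∣.∣m∣n⇒∣m-n (ℤ∣.∣n⇒∣m*n B (ℤ∣.∣ᵤ⇒∣ (gcd[m,n]∣n n ∣ P ∣)))
                  (ℤ∣.∣n⇒∣m*n Y (subst (+ d ℤ∣.∣_) +n≡N (ℤ∣.∣ᵤ⇒∣ (gcd[m,n]∣m n ∣ P ∣)))))
    where
    identity : ∀ B X Y → X ℤ.* B ℤ.- Y ≡ B ℤ.* (X ℤ.+ B ℤ.* Y) ℤ.- Y ℤ.* (B ℤ.* B ℤ.+ + 1)
    identity = ℤ-Solver.solve-∀

  h∣XB-B+Y : + h ℤ∣.∣ X ℤ.* B ℤ.- B ℤ.+ Y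
  h∣XB-B+Y = subst (+ h ℤ∣.∣_) (sym (identity B X Y))
    (ℤ∣.∣m∣n⇒∣m-n (ℤ∣.∣n⇒∣m*n Y (subst (+ h ℤ∣.∣_) +n≡N (ℤ∣.∣ᵤ⇒∣ (gcd[m,n]∣m n ∣ Q ∣))))
                  (ℤ∣.∣n⇒∣m*n B (ℤ∣.∣ᵤ⇒∣ (gcd[m,n]∣n n ∣ Q ∣))))
    where
    identity : ∀ B X Y → X ℤ.* B ℤ.- B ℤ.+ Y ≡ Y ℤ.* (B ℤ.* B ℤ.+ + 1) ℤ.- B ℤ.* (+ 1 ℤ.- X ℤ.+ B ℤ.* Y)
    identity = ℤ-Solver.solve-∀

integral-reduced-forms : ∀ b0 x0 y0 → OnV1 (b0 , x0 , y0) → y0 ≢ 0ℚ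
  → ∀ B X Y → b0 ≡ ℤtoℚ B → x0 ≡ ℤtoℚ X → y0 ≡ ℤtoℚ Y
  → (∃ λ v → ReducedDirection v × Parallel (cone (x0 - 1ℚ) y0) (toℚ³ v) × proj₁ v ≡ + DOf B X Y)
  × (∃ λ v → ReducedDirection v × Parallel (cone x0 y0) (toℚ³ v) × proj₁ v ≡ + dOf B X Y)
integral-reduced-forms _ _ _ P∈V₁ y≢0 B X Y refl refl refl =
  through (X ℤ.* B ℤ.- Y) P (cone∥w₁′ b x y P∈V₁ y≢0)
    (cong₂ _,_ image-n (cong₂ _,_ image-XB-Y image-P)) refl
    (reduced-form n (X ℤ.* B ℤ.- Y) P n≢0 d∣XB-Y) ,
  through (X ℤ.* B ℤ.- B ℤ.+ Y) Q (cone∥w₂′ b x y P∈V₁ y≢0)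
    (cong₂ _,_ image-n (cong₂ _,_ image-XB-B+Y image-Q)) n/h≡d
    (reduced-form n (X ℤ.* B ℤ.- B ℤ.+ Y) Q n≢0 h∣XB-B+Y)
  where
  b x y : ℚ
  b = ℤtoℚ B
  x = ℤtoℚ X
  y = ℤtoℚ Y
  image-P : ℤtoℚ (X ℤ.+ B ℤ.* Y) ≡ x + b * y
  image-P = trans (ℤtoℚ-+ X (B ℤ.* Y)) (cong (λ z → x + z) (ℤtoℚ-* B Y))
  image-E : ℤtoℚ (X ℤ.* X ℤ.+ Y ℤ.* Y ℤ.- (X ℤ.+ B ℤ.* Y)) ≡ (x * x + y * y) - (x + b * y)
  image-E = trans (ℤtoℚ-- (X ℤ.* X ℤ.+ Y ℤ.* Y) (X ℤ.+ B ℤ.* Y))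
    (cong₂ _-_ (trans (ℤtoℚ-+ (X ℤ.* X) (Y ℤ.* Y)) (cong₂ _+_ (ℤtoℚ-* X X) (ℤtoℚ-* Y Y))) image-P)
  open IntegralPoint B X Y (ℤtoℚ-injective {j = + 0} (trans image-E P∈V₁))
  image-n : ℤtoℚ (+ n) ≡ b * b + 1ℚ
  image-n = trans (cong ℤtoℚ +n≡N) (trans (ℤtoℚ-+ (B ℤ.* B) (+ 1)) (cong (λ z → z + 1ℚ) (ℤtoℚ-* B B)))
  image-Q : ℤtoℚ (+ 1 ℤ.- X ℤ.+ B ℤ.* Y) ≡ 1ℚ - x + b * y
  image-Q = trans (ℤtoℚ-+ (+ 1 ℤ.- X) (B ℤ.* Y)) (cong₂ _+_ (ℤtoℚ-- (+ 1) X) (ℤtoℚ-* B Y))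
  image-XB-Y : ℤtoℚ (X ℤ.* B ℤ.- Y) ≡ x * b - y
  image-XB-Y = trans (ℤtoℚ-- (X ℤ.* B) Y) (cong (λ z → z - y) (ℤtoℚ-* X B))
  image-XB-B+Y : ℤtoℚ (X ℤ.* B ℤ.- B ℤ.+ Y) ≡ x * b - b + y
  image-XB-B+Y = trans (ℤtoℚ-+ (X ℤ.* B ℤ.- B) Y)
    (cong (λ z → z + y) (trans (ℤtoℚ-- (X ℤ.* B) B) (cong (λ z → z - b) (ℤtoℚ-* X B))))
  through : ∀ {w w′ k k′} M R → Parallel w w′ → toℚ³ (+ n , M , R) ≡ w′ → k ≡ k′
    → ∃ (λ v → ReducedDirection v × Parallel (toℚ³ (+ n , M , R)) (toℚ³ v) × proj₁ v ≡ + k)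
    → ∃ (λ v → ReducedDirection v × Parallel w (toℚ³ v) × proj₁ v ≡ + k′)
  through _ _ w∥w′ refl refl (v , reduced , parallel , first) =
    v , reduced , parallel-trans w∥w′ parallel , first

proposition4p2 :
    ∀ (b0 x0 y0 : ℚ) → OnV1 (b0 , x0 , y0)
    → ¬ (x0 ≡ 0ℚ × y0 ≡ 0ℚ) → ¬ (x0 ≡ 1ℚ × y0 ≡ 0ℚ)
    → let P = (b0 , x0 , y0)
          w₁ = (((x0 - 1ℚ) * (x0 - 1ℚ) + y0 * y0) , ((x0 - 1ℚ) * y0) , (y0 * y0))
          w₂ = ((x0 * x0 + y0 * y0) , (x0 * y0) , (y0 * y0))
          w₁' = ((b0 * b0 + 1ℚ) , (x0 * b0 - y0) , (x0 + b0 * y0))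
      in (w₁ ≢ 0v × w₂ ≢ 0v × LineInV1 P w₁ × LineInV1 P w₂ × ¬ Parallel w₁ w₂
           × (∀ (w : Point) → w ≢ 0v → LineInV1 P w → Parallel w₁ w ⊎ Parallel w₂ w))
         × Parallel w₁ w₁'
         × (∀ (B X Y : ℤ) → b0 ≡ ℤtoℚ B → x0 ≡ ℤtoℚ X → y0 ≡ ℤtoℚ Y
             → (∃ λ (v : ZPoint) → ReducedDirection v × Parallel w₁ (toℚ³ v)
                   × proj₁ v ≡ + DOf B X Y)
             × (∃ λ (v : ZPoint) → ReducedDirection v × Parallel w₂ (toℚ³ v)
                   × proj₁ v ≡ + dOf B X Y))
proposition4p2 b0 x0 y0 P∈V₁ off₀ off₁ =
  ( cone≢0v (x0 - 1ℚ) y≢0 , cone≢0v x0 y≢0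
  , cone-line-in-V₁ b0 x0 y0 (x0 - 1ℚ) P∈V₁ (x-1-is-root x0)
  , cone-line-in-V₁ b0 x0 y0 x0 P∈V₁ (x-is-root x0)
  , cones-not-parallel x0 y≢0
  , λ w w≢0 line → line-in-V₁⇒parallel b0 x0 y0 w y≢0 w≢0 line )
  , cone∥w₁′ b0 x0 y0 P∈V₁ y≢0
  , integral-reduced-forms b0 x0 y0 P∈V₁ y≢0
  where
  y≢0 : y0 ≢ 0ℚ
  y≢0 = off-lines⇒y≢0 b0 x0 y0 P∈V₁ off₀ off₁
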